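{- Let $G=(S,T;E)$ with $S=\{s_1,\dots,s_n\}$, $w:E\to\mathbb R_+$ and $d\in\mathbb Z_+$. Then the optimum value of the linear program (LP1) is at most $\left(2-\frac{1}{2d-1}\right)$ times the maximum weight of a $d$-distance matching of $G$; that is, the integrality gap of (LP1) is at most $2-\frac{1}{2d-1}$.
   Context: $G$ is a finite bipartite graph without loops or parallel edges; the nodes of $S$ are in the fixed order $s_1,\dots,s_n$. A $d$-distance matching is a subset $M\subseteq E$ such that every node of $S$ is incident to at most one edge of $M$, and whenever $s_it,s_jt\in M$ with $i\ne j$, $t\in T$, we have $|j-i|\ge d$; its weight is $\sum_{e\in M}w(e)$. $\Delta(v)$ is the set of edges incident to $v$, and $R_d(s_i)=\{s_i,\dots,s_{\min(i+d-1,n)}\}$. (LP1) is: maximize $\sum_{st\in E}w_{st}x_{st}$ subject to $x\in\mathbb R_+^E$, $\sum_{st\in\Delta(s)}x_{st}\le 1$ for all $s\in S$, and $\sum_{s't\in E:\,s'\in R_d(s)}x_{s't}\le1$ for all $s\in S,t\in T$.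
   Formalization: The edge weights w and the variables x of (LP1) take values in the nonnegative rationals rather than in $\mathbb R_+$. -}

module Defs where

open import Data.Nat as ℕ using (ℕ; zero; suc)
open import Data.Fin using (Fin; toℕ) renaming (zero to fzero; suc to fsuc)
open import Data.Bool using (Bool; true; false; if_then_else_; _∧_)
open import Data.Product using (_×_)
open import Data.Integer using (+_)
open import Data.Rational using (ℚ; 0ℚ; 1ℚ; _+_; _-_; _*_; _≤_; _/_)
open import Relation.Binary.PropositionalEquality using (_≡_; _≢_)
open import Relation.Nullary using (does)

Σ[<_] : (n : ℕ) → (Fin n → ℚ) → ℚ
Σ[< zero ] f = 0ℚ
Σ[< suc n ] f = f fzero + Σ[< n ] (λ i → f (fsuc i))

-- A finite simple bipartite graph G = (S, T; E) with S = {s_0,...,s_{n-1}}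
-- (in this order, via toℕ) and T = Fin m; E is given by its adjacency matrix.
Graph : ℕ → ℕ → Set
Graph n m = Fin n → Fin m → Bool

onE : ∀ {n m} → Graph n m → (Fin n → Fin m → ℚ) → Fin n → Fin m → ℚ
onE E f s t = if E s t then f s t else 0ℚ

NonNegW : ∀ {n m} → Graph n m → (Fin n → Fin m → ℚ) → Set
NonNegW E w = ∀ s t → E s t ≡ true → 0ℚ ≤ w s t

inR : ∀ {n} → ℕ → Fin n → Fin n → Bool
inR d i j = does (toℕ i ℕ.≤? toℕ j) ∧ does (toℕ j ℕ.<? toℕ i ℕ.+ d)

LP1-feasible : ∀ {n m} → Graph n m → ℕ → (Fin n → Fin m → ℚ) → Set
LP1-feasible {n} {m} E d x =
  (∀ s t → E s t ≡ true → 0ℚ ≤ x s t)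
  × (∀ s → Σ[< m ] (λ t → onE E x s t) ≤ 1ℚ)
  × (∀ s t → Σ[< n ] (λ s′ → if inR d s s′ then onE E x s′ t else 0ℚ) ≤ 1ℚ)

LP1-value : ∀ {n m} → Graph n m → (Fin n → Fin m → ℚ) → (Fin n → Fin m → ℚ) → ℚ
LP1-value {n} {m} E w x = Σ[< n ] (λ s → Σ[< m ] (λ t → onE E (λ a b → w a b * x a b) s t))

distance : ℕ → ℕ → ℕ
distance a b = (a ℕ.∸ b) ℕ.+ (b ℕ.∸ a)

IsDDistMatching : ∀ {n m} → Graph n m → ℕ → (Fin n → Fin m → Bool) → Set
IsDDistMatching E d M =
  (∀ s t → M s t ≡ true → E s t ≡ true)
  × (∀ s t t′ → M s t ≡ true → M s t′ ≡ true → t ≡ t′)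
  × (∀ i j t → M i t ≡ true → M j t ≡ true → i ≢ j → d ℕ.≤ distance (toℕ i) (toℕ j))

weight : ∀ {n m} → (Fin n → Fin m → ℚ) → (Fin n → Fin m → Bool) → ℚ
weight {n} {m} w M = Σ[< n ] (λ s → Σ[< m ] (λ t → if M s t then w s t else 0ℚ))

-- The ratio 2 - 1/(2d-1) for d = suc k, i.e. 2d-1 = 1 + 2k.
ratio : ℕ → ℚ
ratio k = (+ 2 / 1) - (+ 1 / suc (2 ℕ.* k))

{-# OPTIONS --safe #-}
module Submission where

-- Local ratio. Induct on the number of edges of positive weight u (initially u = w). Let s_i be
-- the leftmost node of S carrying such an edge, X the x-mass of these edges at s_i, and y t the
-- x-mass at t of the other nodes of the window R_d(s_i). The window constraints give
-- x(s_i t) + y t ≤ 1 and the degree constraints give Σ_t y t ≤ d - 1, so averaging over the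
-- positive edges at s_i yields one, s_i t₀, with X + y t₀ ≤ 2 - 1/(2d-1). Subtract ε = u(s_i t₀)
-- from the positive edges that conflict with s_i t₀ (those at s_i, and those at t₀ from the rest of
-- the window), truncating at 0; this removes s_i t₀ and costs at most ε (X + y t₀) of LP value.
-- A matching that is good for the reduced weight either uses a conflicting edge, and so gains ε,
-- or, since all its edges lie at or to the right of s_i, can be extended by s_i t₀.


open import Defs
open import Algebra.Bundles using (CommutativeRing)
open import Data.Bool using (Bool; true; false; if_then_else_; _∧_; _∨_)
open import Data.Bool.Properties using (∧-zeroʳ)
open import Data.Nat as ℕ using (ℕ; zero; suc; _∸_)
import Data.Nat.Properties as ℕ
import Data.Nat.Induction as ℕ
import Data.Nat.Coprimality as Coprime
import Data.Integer as ℤ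
import Data.Integer.Properties as ℤ
open import Data.Fin as Fin using (Fin; toℕ) renaming (zero to fzero; suc to fsuc)
open import Data.Rational
  using (ℚ; 0ℚ; 1ℚ; _+_; _-_; -_; _*_; _≤_; _<_; _/_; _⊔_; mkℚ; 1/_; nonNegative)
open import Data.Rational.Properties hiding (_≟_)
open import Data.Fin.Properties using (_≟_; any?; toℕ-injective)
import Data.Bool.Properties as Bool
open import Relation.Nullary using (Dec; does; yes; no)
open import Relation.Nullary.Decidable using (dec-true; dec-false; _×-dec_)
open import Data.Empty using (⊥-elim)
open import Data.Product using (∃; _×_; _,_; proj₁; proj₂)
open import Function using (_∘_)
open import Relation.Binary.Definitions using (tri<; tri≈; tri>)
open import Data.Sum using (_⊎_; inj₁; inj₂; [_,_]′)
open import Induction.WellFounded using (Acc; acc)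
open import Relation.Nullary using (¬_)
open import Relation.Unary using (Pred; Decidable)
open import Data.Rational.Solver using (module +-*-Solver)
open import Relation.Binary.PropositionalEquality

open import Algebra.Properties.Semiring.Sum (CommutativeRing.semiring +-*-commutativeRing)
  using (sum; sum-syntax; sum-cong-≗; ∑-distrib-+; ∑-comm; *-distribˡ-sum; sum-replicate-zero)
import Algebra.Properties.Monoid.Sum ℕ.+-0-monoid as ℕΣ
open import Algebra.Properties.Monoid.Mult +-0-monoid using (×-homo-+) renaming (_×_ to _×ℚ_)

open +-*-Solver using (solve; _:+_; _:-_; _:*_; _:=_; con)

p≤q⇒0≤q-p : ∀ {p q} → p ≤ q → 0ℚ ≤ q - p
p≤q⇒0≤q-p {p} {q} p≤q = ≤-trans (≤-reflexive (sym (+-inverseʳ p))) (+-monoˡ-≤ (- p) p≤q)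

p<q⇒0<q-p : ∀ {p q} → p < q → 0ℚ < q - p
p<q⇒0<q-p {p} {q} p<q = <-respˡ-≡ (+-inverseʳ p) (+-monoˡ-< (- p) p<q)

0≤q-p⇒p≤q : ∀ {p q} → 0ℚ ≤ q - p → p ≤ q
0≤q-p⇒p≤q {p} {q} 0≤q-p = ≤-trans (≤-reflexive (sym (+-identityˡ p)))
  (≤-trans (+-monoˡ-≤ p 0≤q-p) (≤-reflexive (solve 2 (λ q p → q :- p :+ p := q) refl q p)))

0<q-p⇒p<q : ∀ {p q} → 0ℚ < q - p → p < q
0<q-p⇒p<q {p} {q} 0<q-p = <-≤-trans (<-respˡ-≡ (+-identityˡ p) (+-monoˡ-< p 0<q-p))
  (≤-reflexive (solve 2 (λ q p → q :- p :+ p := q) refl q p))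

0<p⊔0⇒p⊔0≡p : ∀ {p} → 0ℚ < p ⊔ 0ℚ → p ⊔ 0ℚ ≡ p
0<p⊔0⇒p⊔0≡p {p} 0<p⊔0 with ≤-total p 0ℚ
... | inj₁ p≤0 = ⊥-elim (<-irrefl refl (<-≤-trans 0<p⊔0 (≤-reflexive (p≤q⇒p⊔q≡q p≤0))))
... | inj₂ 0≤p = p≥q⇒p⊔q≡p 0≤p

*-nonNeg : ∀ {p q} → 0ℚ ≤ p → 0ℚ ≤ q → 0ℚ ≤ p * q
*-nonNeg {p} {q} 0≤p 0≤q =
  nonNegative⁻¹ (p * q) {{nonNeg*nonNeg⇒nonNeg p {{nonNegative 0≤p}} q {{nonNegative 0≤q}}}}

*-monoˡ-≤-≥0 : ∀ {r p q} → 0ℚ ≤ r → p ≤ q → r * p ≤ r * q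
*-monoˡ-≤-≥0 {r} 0≤r = *-monoˡ-≤-nonNeg r {{nonNegative 0≤r}}

*-monoʳ-≤-≥0 : ∀ {r p q} → 0ℚ ≤ r → p ≤ q → p * r ≤ q * r
*-monoʳ-≤-≥0 {r} 0≤r = *-monoʳ-≤-nonNeg r {{nonNegative 0≤r}}

a*D<[1-D]*y : ∀ {a y D} → 0ℚ ≤ D → D < y → a + y ≤ 1ℚ → a * D < (1ℚ - D) * y
a*D<[1-D]*y {a} {y} {D} 0≤D D<y a+y≤1 = 0<q-p⇒p<q (<-≤-trans
  (+-mono-≤-< (*-nonNeg (p≤q⇒0≤q-p a+y≤1) 0≤D) (p<q⇒0<q-p D<y))
  (≤-reflexive (solve 3 (λ a y D → (con 1ℚ :- (a :+ y)) :* D :+ (y :- D)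
                                   := (con 1ℚ :- D) :* y :- a :* D) refl a y D)))

true≢false : true ≢ false
true≢false ()

∧-true⁻ : ∀ {a b} → a ∧ b ≡ true → a ≡ true × b ≡ true
∧-true⁻ {true} b≡true = refl , b≡true

does-true⇒ : ∀ {p} {P : Set p} (P? : Dec P) → does P? ≡ true → P
does-true⇒ (yes p) _  = p
does-true⇒ (no _)  ()

infix 10 ⟪_⟫_
⟪_⟫_ : Bool → ℚ → ℚ
⟪ b ⟫ q = if b then q else 0ℚ

⟪⟫-nonNeg : ∀ b {q} → (b ≡ true → 0ℚ ≤ q) → 0ℚ ≤ ⟪ b ⟫ q
⟪⟫-nonNeg true  0≤q = 0≤q refl
⟪⟫-nonNeg false 0≤q = ≤-refl

⟪⟫-mono : ∀ {a b q} → (a ≡ true → b ≡ true) → (b ≡ true → 0ℚ ≤ q) → ⟪ a ⟫ q ≤ ⟪ b ⟫ q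
⟪⟫-mono {false} {b} a⇒b 0≤q = ⟪⟫-nonNeg b 0≤q
⟪⟫-mono {true}      a⇒b 0≤q rewrite a⇒b refl = ≤-refl

⟪∨⟫≤ : ∀ a b {q} → 0ℚ ≤ q → ⟪ a ∨ b ⟫ q ≤ ⟪ a ⟫ q + ⟪ b ⟫ q
⟪∨⟫≤ true  b {q} 0≤q = ≤-trans (≤-reflexive (sym (+-identityʳ q))) (+-monoʳ-≤ q (⟪⟫-nonNeg b (λ _ → 0≤q)))
⟪∨⟫≤ false b     0≤q = ≤-reflexive (sym (+-identityˡ _))

⟪⟫-monoʳ : ∀ b {p q} → p ≤ q → ⟪ b ⟫ p ≤ ⟪ b ⟫ q
⟪⟫-monoʳ true  p≤q = p≤q
⟪⟫-monoʳ false p≤q = ≤-refl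

⟪⟫-* : ∀ b p q → ⟪ b ⟫ p * q ≡ p * ⟪ b ⟫ q
⟪⟫-* true  p q = refl
⟪⟫-* false p q = trans (*-zeroˡ q) (sym (*-zeroʳ p))

⟪∧⟫ : ∀ a b {q} → ⟪ a ∧ b ⟫ q ≡ ⟪ a ⟫ ⟪ b ⟫ q
⟪∧⟫ true  b = refl
⟪∧⟫ false b = refl

Σ[<]≡sum : ∀ {n} (f : Fin n → ℚ) → Σ[< n ] f ≡ sum f
Σ[<]≡sum {zero}  f = refl
Σ[<]≡sum {suc n} f = cong (f fzero +_) (Σ[<]≡sum (λ i → f (fsuc i)))

sum-mono-≤ : ∀ {n} {f g : Fin n → ℚ} → (∀ i → f i ≤ g i) → sum f ≤ sum g
sum-mono-≤ {zero}  f≤g = ≤-refl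
sum-mono-≤ {suc n} f≤g = +-mono-≤ (f≤g fzero) (sum-mono-≤ (λ i → f≤g (fsuc i)))

sum-mono-< : ∀ {n} {f g : Fin n → ℚ} → (∀ i → f i ≤ g i) → ∀ j → f j < g j → sum f < sum g
sum-mono-< {suc n} f≤g fzero    fj<gj = +-mono-<-≤ fj<gj (sum-mono-≤ (λ i → f≤g (fsuc i)))
sum-mono-< {suc n} f≤g (fsuc j) fj<gj = +-mono-≤-< (f≤g fzero) (sum-mono-< (λ i → f≤g (fsuc i)) j fj<gj)

sum-nonNeg : ∀ {n} {f : Fin n → ℚ} → (∀ i → 0ℚ ≤ f i) → 0ℚ ≤ sum f
sum-nonNeg {n} 0≤f = ≤-trans (≤-reflexive (sym (sum-replicate-zero n))) (sum-mono-≤ 0≤f)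

term≤sum : ∀ {n} {f : Fin n → ℚ} → (∀ i → 0ℚ ≤ f i) → ∀ j → f j ≤ sum f
term≤sum {suc n} {f} 0≤f fzero =
  ≤-trans (≤-reflexive (sym (+-identityʳ (f fzero)))) (+-monoʳ-≤ (f fzero) (sum-nonNeg (λ i → 0≤f (fsuc i))))
term≤sum {suc n} {f} 0≤f (fsuc j) =
  ≤-trans (≤-reflexive (sym (+-identityˡ (f (fsuc j))))) (+-mono-≤ (0≤f fzero) (term≤sum (λ i → 0≤f (fsuc i)) j))

sum-⟪⟫ : ∀ {n} b (f : Fin n → ℚ) → ∑[ i < n ] ⟪ b ⟫ f i ≡ ⟪ b ⟫ sum f
sum-⟪⟫ {n} true  f = refl
sum-⟪⟫ {n} false f = sum-replicate-zero n

sum-δ : ∀ {n} (j : Fin n) (f : Fin n → ℚ) → ∑[ i < n ] ⟪ does (i ≟ j) ⟫ f i ≡ f j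
sum-δ {suc n} fzero f = trans (cong (f fzero +_) (sum-replicate-zero n)) (+-identityʳ (f fzero))
sum-δ {suc n} (fsuc j) f = trans (+-identityˡ _) (sum-δ j (λ i → f (fsuc i)))

sum₂ : ∀ {n m} → (Fin n → Fin m → ℚ) → ℚ
sum₂ f = ∑[ s < _ ] sum (f s)

Σ[<]₂≡sum₂ : ∀ {n m} (f : Fin n → Fin m → ℚ) → Σ[< n ] (λ s → Σ[< m ] (f s)) ≡ sum₂ f
Σ[<]₂≡sum₂ {n} {m} f = trans (Σ[<]≡sum (λ s → Σ[< m ] (f s))) (sum-cong-≗ {n} (λ s → Σ[<]≡sum (f s)))

sum₂-mono-≤ : ∀ {n m} {f g : Fin n → Fin m → ℚ} → (∀ s t → f s t ≤ g s t) → sum₂ f ≤ sum₂ g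
sum₂-mono-≤ f≤g = sum-mono-≤ (λ s → sum-mono-≤ (f≤g s))

sum₂-distrib-+ : ∀ {n m} (f g : Fin n → Fin m → ℚ) → sum₂ (λ s t → f s t + g s t) ≡ sum₂ f + sum₂ g
sum₂-distrib-+ {n} f g =
  trans (sum-cong-≗ {n} (λ s → ∑-distrib-+ (f s) (g s))) (∑-distrib-+ (λ s → sum (f s)) (λ s → sum (g s)))

*-distribˡ-sum₂ : ∀ {n m} p (f : Fin n → Fin m → ℚ) → p * sum₂ f ≡ sum₂ (λ s t → p * f s t)
*-distribˡ-sum₂ {n} p f = trans (*-distribˡ-sum p (λ s → sum (f s))) (sum-cong-≗ {n} (λ s → *-distribˡ-sum p (f s)))

term≤sum₂ : ∀ {n m} {f : Fin n → Fin m → ℚ} → (∀ s t → 0ℚ ≤ f s t) → ∀ s t → f s t ≤ sum₂ f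
term≤sum₂ 0≤f s t = ≤-trans (term≤sum (0≤f s) t) (term≤sum (λ s → sum-nonNeg (0≤f s)) s)

sum₂-zero : ∀ n m → sum₂ {n} {m} (λ _ _ → 0ℚ) ≡ 0ℚ
sum₂-zero n m = trans (sum-cong-≗ {n} (λ _ → sum-replicate-zero m)) (sum-replicate-zero n)

sum₂-δ-row : ∀ {n m} (i : Fin n) (f : Fin n → Fin m → ℚ) →
  sum₂ (λ s t → ⟪ does (s ≟ i) ⟫ f s t) ≡ sum (f i)
sum₂-δ-row {n} i f = trans (sum-cong-≗ {n} (λ s → sum-⟪⟫ (does (s ≟ i)) (f s))) (sum-δ i (λ s → sum (f s)))

sum₂-δ-col : ∀ {n m} (j : Fin m) (f : Fin n → Fin m → ℚ) →
  sum₂ (λ s t → ⟪ does (t ≟ j) ⟫ f s t) ≡ ∑[ s < n ] f s j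
sum₂-δ-col {n} j f = sum-cong-≗ {n} (λ s → sum-δ j (f s))

least? : ∀ {n p} {P : Pred (Fin n) p} → Decidable P →
  (∀ i → ¬ P i) ⊎ ∃ λ i → P i × (∀ j → P j → i Fin.≤ j)
least? {zero}  P? = inj₁ λ ()
least? {suc n} P? with P? fzero
... | yes P0 = inj₂ (fzero , P0 , λ _ _ → ℕ.z≤n)
... | no ¬P0 with least? (λ i → P? (fsuc i))
...   | inj₁ none = inj₁ λ { fzero → ¬P0 ; (fsuc i) → none i }
...   | inj₂ (i , Pi , min) = inj₂ (fsuc i , Pi , λ { fzero P0 → ⊥-elim (¬P0 P0) ; (fsuc j) Pj → ℕ.s≤s (min j Pj) })

ℕsum-mono-≤ : ∀ {n} {f g : Fin n → ℕ} → (∀ i → f i ℕ.≤ g i) → ℕΣ.sum f ℕ.≤ ℕΣ.sum g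
ℕsum-mono-≤ {zero}  f≤g = ℕ.z≤n
ℕsum-mono-≤ {suc n} f≤g = ℕ.+-mono-≤ (f≤g fzero) (ℕsum-mono-≤ (λ i → f≤g (fsuc i)))

ℕsum-mono-< : ∀ {n} {f g : Fin n → ℕ} → (∀ i → f i ℕ.≤ g i) → ∀ j → f j ℕ.< g j → ℕΣ.sum f ℕ.< ℕΣ.sum g
ℕsum-mono-< {suc n} f≤g fzero    fj<gj = ℕ.+-mono-<-≤ fj<gj (ℕsum-mono-≤ (λ i → f≤g (fsuc i)))
ℕsum-mono-< {suc n} f≤g (fsuc j) fj<gj = ℕ.+-mono-≤-< (f≤g fzero) (ℕsum-mono-< (λ i → f≤g (fsuc i)) j fj<gj)

count : ∀ {n m} → Graph n m → ℕ
count P = ℕΣ.sum λ s → ℕΣ.sum λ t → if P s t then 1 else 0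

count-< : ∀ {n m} {P Q : Graph n m} → (∀ s t → Q s t ≡ true → P s t ≡ true) →
  ∀ {i t} → P i t ≡ true → Q i t ≡ false → count Q ℕ.< count P
count-< {P = P} {Q} Q⊆P {i} {t} Pit Qit =
  ℕsum-mono-< (λ s → ℕsum-mono-≤ (indicator-mono s)) i (ℕsum-mono-< (indicator-mono i) t indicator-<)
  where
  indicator-mono : ∀ s t → (if Q s t then 1 else 0) ℕ.≤ (if P s t then 1 else 0)
  indicator-mono s t with Q s t in Qst
  ... | false = ℕ.z≤n
  ... | true rewrite Q⊆P s t Qst = ℕ.≤-refl
  indicator-< : (if Q i t then 1 else 0) ℕ.< (if P i t then 1 else 0)
  indicator-< rewrite Pit | Qit = ℕ.s≤s ℕ.z≤n

between : ℕ → ℕ → ℕ → Bool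
between a b j = does (a ℕ.≤? j) ∧ does (j ℕ.<? b)

between-suc : ∀ a b j → between a b (suc j) ≡ between (a ∸ 1) (b ∸ 1) j
between-suc zero          zero    j = refl
between-suc zero          (suc b) j = refl
between-suc (suc a)       zero    j = trans (∧-zeroʳ _) (sym (∧-zeroʳ _))
between-suc 1             (suc b) j = refl
between-suc (suc (suc a)) (suc b) j = refl

between≡false : ∀ {a b j} → between a b j ≡ false → a ℕ.≤ j → b ℕ.≤ j
between≡false {a} {b} {j} ¬between a≤j = ℕ.≮⇒≥ λ j<b →
  true≢false (trans (sym (cong₂ _∧_ (dec-true (a ℕ.≤? j) a≤j) (dec-true (j ℕ.<? b) j<b))) ¬between)

between-suc-≢ : ∀ {a b j} → a ≢ j → between a b j ≡ between (suc a) b j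
between-suc-≢ {a} {b} {j} a≢j = cong (_∧ does (j ℕ.<? b)) lower
  where
  lower : does (a ℕ.≤? j) ≡ does (suc a ℕ.≤? j)
  lower with ℕ.<-cmp a j
  ... | tri< a<j _ _ = trans (dec-true (a ℕ.≤? j) (ℕ.<⇒≤ a<j)) (sym (dec-true (suc a ℕ.≤? j) a<j))
  ... | tri≈ _ a≡j _ = ⊥-elim (a≢j a≡j)
  ... | tri> _ _ j<a = trans (dec-false (a ℕ.≤? j) (ℕ.<⇒≱ j<a)) (sym (dec-false (suc a ℕ.≤? j) (ℕ.<-asym j<a)))

0≤n×1 : ∀ n → 0ℚ ≤ n ×ℚ 1ℚ
0≤n×1 zero    = ≤-refl
0≤n×1 (suc n) = +-mono-≤ (nonNegative⁻¹ 1ℚ) (0≤n×1 n)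

count-between : ∀ n a b → ∑[ s < n ] ⟪ between a b (toℕ s) ⟫ 1ℚ ≤ (b ∸ a) ×ℚ 1ℚ
count-between zero    a b = 0≤n×1 (b ∸ a)
count-between (suc n) a b = ≤-trans
  (+-monoʳ-≤ (⟪ between a b 0 ⟫ 1ℚ) (≤-trans (≤-reflexive (sum-cong-≗ {n} shift)) (count-between n (a ∸ 1) (b ∸ 1))))
  (first a b)
  where
  shift : ∀ s → ⟪ between a b (suc (toℕ s)) ⟫ 1ℚ ≡ ⟪ between (a ∸ 1) (b ∸ 1) (toℕ s) ⟫ 1ℚ
  shift s = cong (λ β → ⟪ β ⟫ 1ℚ) (between-suc a b (toℕ s))
  first : ∀ a b → ⟪ between a b 0 ⟫ 1ℚ + (b ∸ 1 ∸ (a ∸ 1)) ×ℚ 1ℚ ≤ (b ∸ a) ×ℚ 1ℚ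
  first zero    zero    = ≤-refl
  first zero    (suc b) = ≤-refl
  first (suc a) zero    = ≤-reflexive (trans (+-identityˡ _) (cong (_×ℚ 1ℚ) (ℕ.0∸n≡0 a)))
  first (suc a) (suc b) = ≤-reflexive (+-identityˡ _)

module RatioArithmetic (k : ℕ) where

  K c : ℚ
  K = k ×ℚ 1ℚ
  c = ℤ.+ 1 / suc (2 ℕ.* k)

  n×1≡n/1 : ∀ n → n ×ℚ 1ℚ ≡ mkℚ (ℤ.+ n) 0 (Coprime.sym (Coprime.1-coprimeTo n))
  n×1≡n/1 zero = refl
  n×1≡n/1 (suc n) = trans (cong (1ℚ +_) (n×1≡n/1 n))
    (trans (cong (λ z → (ℤ.+ 1 ℤ.+ z) / 1) (ℤ.*-identityʳ (ℤ.+ n)))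
           (normalize-coprime (Coprime.sym (Coprime.1-coprimeTo (suc n)))))

  c*[1+2K]≡1 : c * (1ℚ + (K + K)) ≡ 1ℚ
  c*[1+2K]≡1 = begin
    c * (1ℚ + (K + K))          ≡⟨ cong (λ z → c * (1ℚ + z)) (sym (×-homo-+ 1ℚ k k)) ⟩
    c * (suc (k ℕ.+ k) ×ℚ 1ℚ)   ≡⟨ cong (λ z → c * (suc (k ℕ.+ z) ×ℚ 1ℚ)) (sym (ℕ.+-identityʳ k)) ⟩
    c * (suc (2 ℕ.* k) ×ℚ 1ℚ)   ≡⟨ cong₂ _*_ (normalize-coprime {1} {2 ℕ.* k} (Coprime.1-coprimeTo _))
                                             (n×1≡n/1 (suc (2 ℕ.* k))) ⟩
    1/ s * s                    ≡⟨ *-inverseˡ s ⟩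
    1ℚ                          ∎
    where
    open ≡-Reasoning
    s = mkℚ (ℤ.+ suc (2 ℕ.* k)) 0 (Coprime.sym (Coprime.1-coprimeTo (suc (2 ℕ.* k))))

  0≤K : 0ℚ ≤ K
  0≤K = 0≤n×1 k

  0≤c : 0ℚ ≤ c
  0≤c = nonNegative⁻¹ c {{normalize-nonNeg 1 (suc (2 ℕ.* k))}}

  1-c*[1+K]≡c*K : 1ℚ - c * (1ℚ + K) ≡ c * K
  1-c*[1+K]≡c*K = begin
    1ℚ - c * (1ℚ + K)                   ≡⟨ cong (_- c * (1ℚ + K)) (sym c*[1+2K]≡1) ⟩
    c * (1ℚ + (K + K)) - c * (1ℚ + K)   ≡⟨ solve 2 (λ c K → c :* (con 1ℚ :+ (K :+ K)) :- c :* (con 1ℚ :+ K)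
                                                     := c :* K) refl c K ⟩
    c * K                               ∎
    where open ≡-Reasoning

  0≤1-c*[1+K] : 0ℚ ≤ 1ℚ - c * (1ℚ + K)
  0≤1-c*[1+K] = ≤-trans (*-nonNeg 0≤c 0≤K) (≤-reflexive (sym 1-c*[1+K]≡c*K))

  0≤1-c : 0ℚ ≤ 1ℚ - c
  0≤1-c = ≤-trans (+-mono-≤ 0≤1-c*[1+K] (*-nonNeg 0≤c 0≤K))
    (≤-reflexive (solve 2 (λ c K → con 1ℚ :- c :* (con 1ℚ :+ K) :+ c :* K := con 1ℚ :- c) refl c K))

  0≤ratio-X : ∀ {X} → X ≤ 1ℚ → 0ℚ ≤ ratio k - X
  0≤ratio-X {X} X≤1 = ≤-trans (+-mono-≤ (p≤q⇒0≤q-p X≤1) 0≤1-c)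
    (≤-reflexive (solve 2 (λ X c → (con 1ℚ :- X) :+ (con 1ℚ :- c) := ((con 1ℚ :+ con 1ℚ) :- c) :- X) refl X c))

  0≤ratio : 0ℚ ≤ ratio k
  0≤ratio = ≤-trans (0≤ratio-X (nonNegative⁻¹ 1ℚ)) (≤-reflexive (+-identityʳ (ratio k)))

  -- With r = 2 - c: X (r - X) - (1 - r + X) K = (1 - X)(1 - c)K + X(1 - c(1 + K)) + X(1 - X),
  -- and 1 - c(1 + K) = cK ≥ 0.
  ratio-balance : ∀ {X} → 0ℚ ≤ X → X ≤ 1ℚ → (1ℚ - (ratio k - X)) * K ≤ X * (ratio k - X)
  ratio-balance {X} 0≤X X≤1 = 0≤q-p⇒p≤q (≤-trans
    (+-mono-≤ (+-mono-≤ (*-nonNeg 0≤1-X (*-nonNeg 0≤1-c 0≤K)) (*-nonNeg 0≤X 0≤1-c*[1+K])) (*-nonNeg 0≤X 0≤1-X))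
    (≤-reflexive (solve 3 (λ X c K →
        (con 1ℚ :- X) :* ((con 1ℚ :- c) :* K) :+ X :* (con 1ℚ :- c :* (con 1ℚ :+ K)) :+ X :* (con 1ℚ :- X)
      := X :* (((con 1ℚ :+ con 1ℚ) :- c) :- X) :- (con 1ℚ :- (((con 1ℚ :+ con 1ℚ) :- c) :- X)) :* K) refl X c K)))
    where 0≤1-X = p≤q⇒0≤q-p X≤1

-- Were X + y t > ratio k for every t in A, then with D = ratio k - X summing a t · D < (1 - D) · y t
-- over A would give X · D < (1 - D) · K, contradicting ratio-balance.
light-index : ∀ k {m} (A : Fin m → Bool) (a y : Fin m → ℚ) → (∀ t → A t ≡ true → 0ℚ ≤ a t) →
  (∀ t → 0ℚ ≤ y t) → (∀ t → A t ≡ true → a t + y t ≤ 1ℚ) → ∑[ t < m ] ⟪ A t ⟫ a t ≤ 1ℚ → sum y ≤ k ×ℚ 1ℚ →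
  ∀ {t₀} → A t₀ ≡ true → ∃ λ t → A t ≡ true × ∑[ t < m ] ⟪ A t ⟫ a t + y t ≤ ratio k
light-index k A a y 0≤a 0≤y a+y≤1 X≤1 ∑y≤K {t₀} A-t₀
  with any? (λ t → (A t Bool.≟ true) ×-dec (∑[ t < _ ] ⟪ A t ⟫ a t + y t ≤? ratio k))
... | yes light = light
... | no none = ⊥-elim (<-irrefl refl (begin-strict
  X * D                          ≡⟨ *-comm X D ⟩
  D * X                          ≡⟨ *-distribˡ-sum D (λ t → ⟪ A t ⟫ a t) ⟩
  ∑[ t < _ ] (D * ⟪ A t ⟫ a t)   <⟨ sum-mono-< below t₀ below-t₀ ⟩
  ∑[ t < _ ] ((1ℚ - D) * y t)    ≡⟨ *-distribˡ-sum (1ℚ - D) y ⟨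
  (1ℚ - D) * sum y               ≤⟨ *-monoˡ-≤-≥0 (p≤q⇒0≤q-p D≤1) ∑y≤K ⟩
  (1ℚ - D) * K                   ≤⟨ ratio-balance (sum-nonNeg (λ t → ⟪⟫-nonNeg (A t) (0≤a t))) X≤1 ⟩
  X * D                          ∎))
  where
  open RatioArithmetic k
  open ≤-Reasoning
  X = ∑[ t < _ ] ⟪ A t ⟫ a t
  D = ratio k - X
  0≤D : 0ℚ ≤ D
  0≤D = 0≤ratio-X X≤1
  D<y : ∀ {t} → A t ≡ true → D < y t
  D<y {t} A-t = 0<q-p⇒p<q (<-≤-trans (p<q⇒0<q-p (≰⇒> (λ light → none (t , A-t , light))))
    (≤-reflexive (solve 3 (λ X y r → X :+ y :- r := y :- (r :- X)) refl X (y t) (ratio k))))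
  D≤1 : D ≤ 1ℚ
  D≤1 = ≤-trans (<⇒≤ (D<y A-t₀)) (≤-trans (≤-trans (≤-reflexive (sym (+-identityˡ (y t₀))))
    (+-monoˡ-≤ (y t₀) (0≤a t₀ A-t₀))) (a+y≤1 t₀ A-t₀))
  below-active : ∀ {t} → A t ≡ true → D * a t < (1ℚ - D) * y t
  below-active {t} A-t = <-respˡ-≡ (*-comm (a t) D) (a*D<[1-D]*y {a t} 0≤D (D<y A-t) (a+y≤1 t A-t))
  below : ∀ t → D * ⟪ A t ⟫ a t ≤ (1ℚ - D) * y t
  below t with A t in A-t
  ... | true  = <⇒≤ (below-active A-t)
  ... | false = ≤-trans (≤-reflexive (*-zeroʳ D)) (*-nonNeg (p≤q⇒0≤q-p D≤1) (0≤y t))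
  below-t₀ : D * ⟪ A t₀ ⟫ a t₀ < (1ℚ - D) * y t₀
  below-t₀ rewrite A-t₀ = below-active A-t₀


distance-comm : ∀ a b → distance a b ≡ distance b a
distance-comm a b = ℕ.+-comm (a ∸ b) (b ∸ a)

addEdge : ∀ {n m} → Graph n m → Fin n → Fin m → Graph n m
addEdge M i j s t = M s t ∨ (does (s ≟ i) ∧ does (t ≟ j))

addEdge-cases : ∀ {n m} {M : Graph n m} {i j s t} → addEdge M i j s t ≡ true → M s t ≡ true ⊎ (s ≡ i × t ≡ j)
addEdge-cases {M = M} {i} {j} {s} {t} e with M s t | s ≟ i | t ≟ j
... | true  | _        | _        = inj₁ refl
... | false | yes s≡i  | yes t≡j  = inj₂ (s≡i , t≡j)
... | false | yes _    | no _     = ⊥-elim (true≢false (sym e))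
... | false | no _     | _        = ⊥-elim (true≢false (sym e))

addEdge-isDDistMatching : ∀ {n m} {E : Graph n m} {d M i j} → IsDDistMatching E d M → E i j ≡ true →
  (∀ t → M i t ≡ false) → (∀ s → M s j ≡ true → d ℕ.≤ distance (toℕ i) (toℕ s)) →
  IsDDistMatching E d (addEdge M i j)
addEdge-isDDistMatching {E = E} {d} {M} {i} {j} (M⊆E , M-deg , M-dist) Eij i-free j-far = ⊆E , deg , dist
  where
  clash : ∀ {t} {A : Set} → M i t ≡ true → A
  clash {t} Mit = ⊥-elim (true≢false (trans (sym Mit) (i-free t)))
  ⊆E : ∀ s t → addEdge M i j s t ≡ true → E s t ≡ true
  ⊆E s t e with addEdge-cases {M = M} e
  ... | inj₁ Mst         = M⊆E s t Mst
  ... | inj₂ (refl , refl) = Eij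
  deg : ∀ s t t′ → addEdge M i j s t ≡ true → addEdge M i j s t′ ≡ true → t ≡ t′
  deg s t t′ e e′ with addEdge-cases {M = M} e | addEdge-cases {M = M} e′
  ... | inj₁ Mst           | inj₁ Mst′          = M-deg s t t′ Mst Mst′
  ... | inj₁ Mit           | inj₂ (refl , refl) = clash Mit
  ... | inj₂ (refl , refl) | inj₁ Mit′          = clash Mit′
  ... | inj₂ (_ , refl)    | inj₂ (_ , refl)    = refl
  dist : ∀ s s′ t → addEdge M i j s t ≡ true → addEdge M i j s′ t ≡ true → s ≢ s′ →
    d ℕ.≤ distance (toℕ s) (toℕ s′)
  dist s s′ t e e′ s≢s′ with addEdge-cases {M = M} e | addEdge-cases {M = M} e′
  ... | inj₁ Mst           | inj₁ Ms′t          = M-dist s s′ t Mst Ms′t s≢s′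
  ... | inj₂ (refl , refl) | inj₁ Ms′j          = j-far s′ Ms′j
  ... | inj₁ Msj           | inj₂ (refl , refl) = subst (d ℕ.≤_) (distance-comm (toℕ i) (toℕ s)) (j-far s Msj)
  ... | inj₂ (refl , _)    | inj₂ (refl , _)    = ⊥-elim (s≢s′ refl)

addEdge-weight : ∀ {n m} (w : Fin n → Fin m → ℚ) {M : Graph n m} {i j} → M i j ≡ false →
  sum₂ (λ s t → ⟪ addEdge M i j s t ⟫ w s t) ≡ sum₂ (λ s t → ⟪ M s t ⟫ w s t) + w i j
addEdge-weight {n} {m} w {M} {i} {j} Mij≡false = begin
  sum₂ (λ s t → ⟪ addEdge M i j s t ⟫ w s t)   ≡⟨ sum-cong-≗ {n} (λ s → sum-cong-≗ {m} (split s)) ⟩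
  sum₂ (λ s t → old s t + new s t)             ≡⟨ sum₂-distrib-+ old new ⟩
  sum₂ old + sum₂ new                          ≡⟨ cong (sum₂ old +_) (trans (sum₂-δ-row i new′) (sum-δ j (w i))) ⟩
  sum₂ old + w i j                             ∎
  where
  open ≡-Reasoning
  old new′ new : Fin _ → Fin _ → ℚ
  old s t  = ⟪ M s t ⟫ w s t
  new′ s t = ⟪ does (t ≟ j) ⟫ w s t
  new s t  = ⟪ does (s ≟ i) ⟫ new′ s t
  split : ∀ s t → ⟪ addEdge M i j s t ⟫ w s t ≡ ⟪ M s t ⟫ w s t + ⟪ does (s ≟ i) ⟫ ⟪ does (t ≟ j) ⟫ w s t
  split s t with M s t in Mst | s ≟ i | t ≟ j
  ... | false | yes _    | yes _ = sym (+-identityˡ _)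
  ... | false | yes _    | no _  = sym (+-identityˡ _)
  ... | false | no _     | _     = sym (+-identityˡ _)
  ... | true  | yes refl | yes refl = ⊥-elim (true≢false (trans (sym Mst) Mij≡false))
  ... | true  | yes _    | no _  = sym (+-identityʳ _)
  ... | true  | no _     | _     = sym (+-identityʳ _)

module LocalRatio {n m : ℕ} (E : Graph n m) (k : ℕ) (x : Fin n → Fin m → ℚ)
  (0≤x : ∀ s t → E s t ≡ true → 0ℚ ≤ x s t)
  (degree : ∀ s → ∑[ t < m ] ⟪ E s t ⟫ x s t ≤ 1ℚ)
  (window : ∀ i t → ∑[ s < n ] ⟪ inR (suc k) i s ⟫ ⟪ E s t ⟫ x s t ≤ 1ℚ) where

  open RatioArithmetic k using (0≤ratio)

  Weight : Set
  Weight = Fin n → Fin m → ℚ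

  supp : Weight → Graph n m
  supp u s t = E s t ∧ does (0ℚ <? u s t)

  value : Weight → ℚ
  value u = sum₂ λ s t → ⟪ E s t ⟫ (u s t * x s t)

  weight′ : Weight → Graph n m → ℚ
  weight′ u M = sum₂ λ s t → ⟪ M s t ⟫ u s t

  record Rounding (u : Weight) : Set where
    field
      M          : Graph n m
      isMatching : IsDDistMatching E (suc k) M
      M⊆supp     : ∀ s t → M s t ≡ true → supp u s t ≡ true
      bound      : value u ≤ ratio k * weight′ u M

  supp⇒E : ∀ u {s t} → supp u s t ≡ true → E s t ≡ true
  supp⇒E u = proj₁ ∘ ∧-true⁻

  supp⇒pos : ∀ u {s t} → supp u s t ≡ true → 0ℚ < u s t
  supp⇒pos u {s} {t} = does-true⇒ (0ℚ <? u s t) ∘ proj₂ ∘ ∧-true⁻ {E s t}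

  supp-intro : ∀ u {s t} → E s t ≡ true → 0ℚ < u s t → supp u s t ≡ true
  supp-intro u {s} {t} Est pos = cong₂ _∧_ Est (dec-true (0ℚ <? u s t) pos)

  ≤0⇒¬supp : ∀ u {s t} → u s t ≤ 0ℚ → supp u s t ≡ false
  ≤0⇒¬supp u {s} {t} u≤0 =
    trans (cong (E s t ∧_) (dec-false (0ℚ <? u s t) (λ pos → <-irrefl refl (<-≤-trans pos u≤0)))) (∧-zeroʳ (E s t))

  ¬supp⇒≤0 : ∀ u {s t} → E s t ≡ true → supp u s t ≡ false → u s t ≤ 0ℚ
  ¬supp⇒≤0 u Est ¬sp = ≮⇒≥ (λ pos → true≢false (trans (sym (supp-intro u Est pos)) ¬sp))

  value-subadditive : ∀ {u v w} → (∀ s t → E s t ≡ true → u s t ≤ v s t + w s t) → value u ≤ value v + value w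
  value-subadditive {u} {v} {w} u≤v+w = ≤-trans (sum₂-mono-≤ pointwise)
    (≤-reflexive (sum₂-distrib-+ (λ s t → ⟪ E s t ⟫ (v s t * x s t)) (λ s t → ⟪ E s t ⟫ (w s t * x s t))))
    where
    pointwise : ∀ s t → ⟪ E s t ⟫ (u s t * x s t) ≤ ⟪ E s t ⟫ (v s t * x s t) + ⟪ E s t ⟫ (w s t * x s t)
    pointwise s t with E s t in Est
    ... | true  = ≤-trans (*-monoʳ-≤-≥0 (0≤x s t Est) (u≤v+w s t Est))
                          (≤-reflexive (*-distribʳ-+ (x s t) (v s t) (w s t)))
    ... | false = ≤-reflexive (sym (+-identityˡ 0ℚ))

  empty-rounding : ∀ u → (∀ s t → supp u s t ≡ false) → Rounding u
  empty-rounding u none = record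
    { M          = λ _ _ → false
    ; isMatching = (λ _ _ ()) , (λ _ _ _ ()) , (λ _ _ _ _ ())
    ; M⊆supp     = λ _ _ ()
    ; bound      = ≤-trans (sum₂-mono-≤ nonPos) (≤-reflexive (trans (sum₂-zero n m)
                     (sym (trans (cong (ratio k *_) (sum₂-zero n m)) (*-zeroʳ (ratio k))))))
    }
    where
    nonPos : ∀ s t → ⟪ E s t ⟫ (u s t * x s t) ≤ 0ℚ
    nonPos s t with E s t in Est
    ... | true  = ≤-trans (*-monoʳ-≤-≥0 (0≤x s t Est) (¬supp⇒≤0 u Est (none s t))) (≤-reflexive (*-zeroˡ (x s t)))
    ... | false = ≤-refl

  strictWindow : Fin n → Fin n → Bool
  strictWindow i s = between (suc (toℕ i)) (toℕ i ℕ.+ suc k) (toℕ s)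

  window-split : ∀ i s q → ⟪ inR (suc k) i s ⟫ q ≡ ⟪ does (s ≟ i) ⟫ q + ⟪ strictWindow i s ⟫ q
  window-split i s q with s ≟ i
  ... | yes refl = trans (cong (λ β → ⟪ β ⟫ q) i∈window)
                         (sym (trans (cong (λ β → q + ⟪ β ⟫ q) i∉strictWindow) (+-identityʳ q)))
    where
    i∈window : inR (suc k) i i ≡ true
    i∈window = cong₂ _∧_ (dec-true (toℕ i ℕ.≤? toℕ i) ℕ.≤-refl)
                         (dec-true (toℕ i ℕ.<? toℕ i ℕ.+ suc k) (ℕ.m<m+n (toℕ i) ℕ.z<s))
    i∉strictWindow : strictWindow i i ≡ false
    i∉strictWindow = cong (_∧ does (toℕ i ℕ.<? toℕ i ℕ.+ suc k)) (dec-false (suc (toℕ i) ℕ.≤? toℕ i) (ℕ.n≮n (toℕ i)))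
  ... | no s≢i = trans (cong (λ β → ⟪ β ⟫ q) (between-suc-≢ {b = toℕ i ℕ.+ suc k} i≢s)) (sym (+-identityˡ _))
    where i≢s = λ i≡s → s≢i (toℕ-injective (sym i≡s))

  y : Fin n → Fin m → ℚ
  y i t = ∑[ s < n ] ⟪ strictWindow i s ⟫ ⟪ E s t ⟫ x s t

  0≤y : ∀ i t → 0ℚ ≤ y i t
  0≤y i t = sum-nonNeg (λ s → ⟪⟫-nonNeg (strictWindow i s) (λ _ → ⟪⟫-nonNeg (E s t) (0≤x s t)))

  x+y≤1 : ∀ {i t} → E i t ≡ true → x i t + y i t ≤ 1ℚ
  x+y≤1 {i} {t} Eit = ≤-trans (≤-reflexive split) (window i t)
    where
    open ≡-Reasoning
    split : x i t + y i t ≡ ∑[ s < n ] ⟪ inR (suc k) i s ⟫ ⟪ E s t ⟫ x s t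
    split = begin
      x i t + y i t
        ≡⟨ cong (_+ y i t) (sym (trans (sum-δ i (λ s → ⟪ E s t ⟫ x s t)) (cong (λ β → ⟪ β ⟫ x i t) Eit))) ⟩
      ∑[ s < n ] ⟪ does (s ≟ i) ⟫ ⟪ E s t ⟫ x s t + y i t
        ≡⟨ ∑-distrib-+ (λ s → ⟪ does (s ≟ i) ⟫ ⟪ E s t ⟫ x s t) (λ s → ⟪ strictWindow i s ⟫ ⟪ E s t ⟫ x s t) ⟨
      ∑[ s < n ] (⟪ does (s ≟ i) ⟫ ⟪ E s t ⟫ x s t + ⟪ strictWindow i s ⟫ ⟪ E s t ⟫ x s t)
        ≡⟨ sum-cong-≗ {n} (λ s → window-split i s (⟪ E s t ⟫ x s t)) ⟨
      ∑[ s < n ] ⟪ inR (suc k) i s ⟫ ⟪ E s t ⟫ x s t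
        ∎

  sum-y≤k : ∀ i → sum (y i) ≤ k ×ℚ 1ℚ
  sum-y≤k i = begin
    ∑[ t < m ] ∑[ s < n ] ⟪ W s ⟫ ⟪ E s t ⟫ x s t   ≡⟨ ∑-comm (λ t s → ⟪ W s ⟫ ⟪ E s t ⟫ x s t) ⟩
    ∑[ s < n ] ∑[ t < m ] ⟪ W s ⟫ ⟪ E s t ⟫ x s t   ≡⟨ sum-cong-≗ {n} (λ s → sum-⟪⟫ (W s) (λ t → ⟪ E s t ⟫ x s t)) ⟩
    ∑[ s < n ] ⟪ W s ⟫ ∑[ t < m ] ⟪ E s t ⟫ x s t   ≤⟨ sum-mono-≤ (λ s → ⟪⟫-monoʳ (W s) (degree s)) ⟩
    ∑[ s < n ] ⟪ W s ⟫ 1ℚ                           ≤⟨ count-between n (suc (toℕ i)) (toℕ i ℕ.+ suc k) ⟩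
    (toℕ i ℕ.+ suc k ∸ suc (toℕ i)) ×ℚ 1ℚ            ≡⟨ cong (_×ℚ 1ℚ) window-length ⟩
    k ×ℚ 1ℚ                                         ∎
    where
    open ≤-Reasoning
    W = strictWindow i
    window-length : toℕ i ℕ.+ suc k ∸ suc (toℕ i) ≡ k
    window-length = trans (cong (_∸ suc (toℕ i)) (ℕ.+-suc (toℕ i) k)) (ℕ.m+n∸m≡n (toℕ i) k)

  X : Weight → Fin n → ℚ
  X u i = ∑[ t < m ] ⟪ supp u i t ⟫ x i t

  light-edge : ∀ u {i t₀} → supp u i t₀ ≡ true → ∃ λ t → supp u i t ≡ true × X u i + y i t ≤ ratio k
  light-edge u {i} = light-index k (supp u i) (x i) (y i) (λ t sp → 0≤x i t (supp⇒E u sp)) (0≤y i)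
    (λ t sp → x+y≤1 (supp⇒E u sp)) (≤-trans (sum-mono-≤ (λ t → ⟪⟫-mono (supp⇒E u) (0≤x i t))) (degree i)) (sum-y≤k i)

  module Step (u : Weight) (0≤u : NonNegW E u) {i : Fin n} {t₀ : Fin m}
              (leftmost : ∀ j t → supp u j t ≡ true → toℕ i ℕ.≤ toℕ j)
              (supp-it₀ : supp u i t₀ ≡ true) (light : X u i + y i t₀ ≤ ratio k) where

    ε : ℚ
    ε = u i t₀

    0≤ε : 0ℚ ≤ ε
    0≤ε = <⇒≤ (supp⇒pos u supp-it₀)

    -- The edges conflicting with s_i t₀ in a d-distance matching all of whose edges lie at or right of s_i.
    nbhd : Graph n m
    nbhd s t = does (s ≟ i) ∨ (does (t ≟ t₀) ∧ strictWindow i s)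

    nbhd-row : ∀ t → nbhd i t ≡ true
    nbhd-row t rewrite dec-true (i ≟ i) refl = refl

    u₁ u′ : Weight
    u₁ s t = ⟪ supp u s t ∧ nbhd s t ⟫ ε
    u′ s t = (u s t - u₁ s t) ⊔ 0ℚ

    0≤u₁ : ∀ s t → 0ℚ ≤ u₁ s t
    0≤u₁ s t = ⟪⟫-nonNeg (supp u s t ∧ nbhd s t) (λ _ → 0≤ε)

    0≤u′ : NonNegW E u′
    0≤u′ s t _ = p≤q⊔p (u s t - u₁ s t) 0ℚ

    u≤u₁+u′ : ∀ s t → u s t ≤ u₁ s t + u′ s t
    u≤u₁+u′ s t = ≤-trans (≤-reflexive (solve 2 (λ a b → a := b :+ (a :- b)) refl (u s t) (u₁ s t)))
      (+-monoʳ-≤ (u₁ s t) (p≤p⊔q (u s t - u₁ s t) 0ℚ))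

    u′≤u : ∀ s t → E s t ≡ true → u′ s t ≤ u s t
    u′≤u s t Est = ⊔-lub (≤-trans (+-monoʳ-≤ (u s t) (neg-antimono-≤ (0≤u₁ s t))) (≤-reflexive (+-identityʳ (u s t))))
                         (0≤u s t Est)

    supp-u′⇒u≡u₁+u′ : ∀ {s t} → supp u′ s t ≡ true → u s t ≡ u₁ s t + u′ s t
    supp-u′⇒u≡u₁+u′ {s} {t} sp = begin
      u s t                        ≡⟨ solve 2 (λ a b → a := b :+ (a :- b)) refl (u s t) (u₁ s t) ⟩
      u₁ s t + (u s t - u₁ s t)    ≡⟨ cong (u₁ s t +_) (0<p⊔0⇒p⊔0≡p (supp⇒pos u′ sp)) ⟨
      u₁ s t + u′ s t              ∎
      where open ≡-Reasoning

    supp-u′⇒supp-u : ∀ s t → supp u′ s t ≡ true → supp u s t ≡ true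
    supp-u′⇒supp-u s t sp = supp-intro u Est (<-≤-trans (supp⇒pos u′ sp) (u′≤u s t Est))
      where Est = supp⇒E u′ sp

    u₁-hit : ∀ {s t} → supp u s t ≡ true → nbhd s t ≡ true → u₁ s t ≡ ε
    u₁-hit {s} {t} sp nb rewrite sp | nb = refl

    ¬supp-u′-it₀ : supp u′ i t₀ ≡ false
    ¬supp-u′-it₀ = ≤0⇒¬supp u′ (≤-reflexive (begin
      (ε - u₁ i t₀) ⊔ 0ℚ   ≡⟨ cong (λ z → (ε - z) ⊔ 0ℚ) (u₁-hit supp-it₀ (nbhd-row t₀)) ⟩
      (ε - ε) ⊔ 0ℚ         ≡⟨ cong (_⊔ 0ℚ) (+-inverseʳ ε) ⟩
      0ℚ ⊔ 0ℚ              ≡⟨ ⊔-idem 0ℚ ⟩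
      0ℚ                   ∎))
      where open ≡-Reasoning

    u₁-pointwise : ∀ s t →
      ⟪ E s t ⟫ (⟪ supp u s t ∧ nbhd s t ⟫ ε * x s t)
        ≤ ε * (⟪ does (s ≟ i) ⟫ ⟪ supp u s t ⟫ x s t + ⟪ does (t ≟ t₀) ⟫ ⟪ strictWindow i s ⟫ ⟪ E s t ⟫ x s t)
    u₁-pointwise s t with supp u s t in sp
    ... | false = ≤-trans (≤-reflexive (masked-zero (E s t)))
                          (*-nonNeg 0≤ε (+-mono-≤ (⟪⟫-nonNeg (does (s ≟ i)) (λ _ → ≤-refl))
                            (⟪⟫-nonNeg (does (t ≟ t₀)) (λ _ → ⟪⟫-nonNeg (strictWindow i s)
                              (λ _ → ⟪⟫-nonNeg (E s t) (0≤x s t))))))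
      where
      masked-zero : ∀ e → ⟪ e ⟫ (0ℚ * x s t) ≡ 0ℚ
      masked-zero true  = *-zeroˡ (x s t)
      masked-zero false = refl
    ... | true rewrite supp⇒E u sp = begin
      ⟪ nbhd s t ⟫ ε * x s t
        ≡⟨ ⟪⟫-* (nbhd s t) ε (x s t) ⟩
      ε * ⟪ nbhd s t ⟫ x s t
        ≤⟨ *-monoˡ-≤-≥0 0≤ε (⟪∨⟫≤ (does (s ≟ i)) (does (t ≟ t₀) ∧ strictWindow i s) (0≤x s t (supp⇒E u sp))) ⟩
      ε * (⟪ does (s ≟ i) ⟫ x s t + ⟪ does (t ≟ t₀) ∧ strictWindow i s ⟫ x s t)
        ≡⟨ cong (λ z → ε * (⟪ does (s ≟ i) ⟫ x s t + z)) (⟪∧⟫ (does (t ≟ t₀)) (strictWindow i s)) ⟩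
      ε * (⟪ does (s ≟ i) ⟫ x s t + ⟪ does (t ≟ t₀) ⟫ ⟪ strictWindow i s ⟫ x s t)
        ∎
      where open ≤-Reasoning

    value-u₁ : value u₁ ≤ ε * ratio k
    value-u₁ = begin
      value u₁                                  ≤⟨ sum₂-mono-≤ u₁-pointwise ⟩
      sum₂ (λ s t → ε * (row s t + col s t))    ≡⟨ *-distribˡ-sum₂ ε (λ s t → row s t + col s t) ⟨
      ε * sum₂ (λ s t → row s t + col s t)      ≡⟨ cong (ε *_) (sum₂-distrib-+ row col) ⟩
      ε * (sum₂ row + sum₂ col)                 ≡⟨ cong (ε *_) (cong₂ _+_ (sum₂-δ-row i row′) (sum₂-δ-col t₀ col′)) ⟩
      ε * (X u i + y i t₀)                      ≤⟨ *-monoˡ-≤-≥0 0≤ε light ⟩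
      ε * ratio k                               ∎
      where
      open ≤-Reasoning
      row′ col′ row col : Fin n → Fin m → ℚ
      row′ s t = ⟪ supp u s t ⟫ x s t
      col′ s t = ⟪ strictWindow i s ⟫ ⟪ E s t ⟫ x s t
      row s t = ⟪ does (s ≟ i) ⟫ row′ s t
      col s t = ⟪ does (t ≟ t₀) ⟫ col′ s t

    bound-from-gain : ∀ M′ M → value u′ ≤ ratio k * weight′ u′ M′ → ε + weight′ u′ M′ ≤ weight′ u M →
      value u ≤ ratio k * weight′ u M
    bound-from-gain M′ M bound′ gain = begin
      value u                                   ≤⟨ value-subadditive {u} {u₁} {u′} (λ s t _ → u≤u₁+u′ s t) ⟩
      value u₁ + value u′                       ≤⟨ +-mono-≤ value-u₁ bound′ ⟩
      ε * ratio k + ratio k * weight′ u′ M′     ≡⟨ cong (_+ ratio k * weight′ u′ M′) (*-comm ε (ratio k)) ⟩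
      ratio k * ε + ratio k * weight′ u′ M′     ≡⟨ *-distribˡ-+ (ratio k) ε (weight′ u′ M′) ⟨
      ratio k * (ε + weight′ u′ M′)             ≤⟨ *-monoˡ-≤-≥0 0≤ratio gain ⟩
      ratio k * weight′ u M                     ∎
      where open ≤-Reasoning

    module Extend (R′ : Rounding u′) where
      open Rounding R′ renaming (M to M′; isMatching to isMatching′; M⊆supp to M′⊆supp′; bound to bound′)

      M′⊆supp : ∀ s t → M′ s t ≡ true → supp u s t ≡ true
      M′⊆supp s t = supp-u′⇒supp-u s t ∘ M′⊆supp′ s t

      conflict-gain : ∀ {s₁ t₁} → M′ s₁ t₁ ∧ nbhd s₁ t₁ ≡ true → ε + weight′ u′ M′ ≤ weight′ u M′
      conflict-gain {s₁} {t₁} hit = begin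
        ε + weight′ u′ M′                 ≤⟨ +-monoˡ-≤ (weight′ u′ M′) ε≤weight′-u₁ ⟩
        weight′ u₁ M′ + weight′ u′ M′     ≡⟨ sum₂-distrib-+ (λ s t → ⟪ M′ s t ⟫ u₁ s t) (λ s t → ⟪ M′ s t ⟫ u′ s t) ⟨
        sum₂ (λ s t → ⟪ M′ s t ⟫ u₁ s t + ⟪ M′ s t ⟫ u′ s t)   ≤⟨ sum₂-mono-≤ recombine ⟩
        weight′ u M′                      ∎
        where
        open ≤-Reasoning
        M′-hit = proj₁ (∧-true⁻ hit)
        ε≤weight′-u₁ : ε ≤ weight′ u₁ M′
        ε≤weight′-u₁ = ≤-trans
          (≤-reflexive (sym (trans (cong (λ β → ⟪ β ⟫ u₁ s₁ t₁) M′-hit)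
                                   (u₁-hit (M′⊆supp s₁ t₁ M′-hit) (proj₂ (∧-true⁻ hit))))))
          (term≤sum₂ (λ s t → ⟪⟫-nonNeg (M′ s t) (λ _ → 0≤u₁ s t)) s₁ t₁)
        recombine : ∀ s t → ⟪ M′ s t ⟫ u₁ s t + ⟪ M′ s t ⟫ u′ s t ≤ ⟪ M′ s t ⟫ u s t
        recombine s t with M′ s t in M′st
        ... | true  = ≤-reflexive (sym (supp-u′⇒u≡u₁+u′ (M′⊆supp′ s t M′st)))
        ... | false = ≤-reflexive (+-identityˡ 0ℚ)

      module Free (free : ∀ s t → M′ s t ∧ nbhd s t ≡ false) where

        row-free : ∀ t → M′ i t ≡ false
        row-free t with M′ i t in M′it
        ... | false = refl
        ... | true  = ⊥-elim (true≢false (trans (sym (nbhd-row t)) (trans (cong (_∧ nbhd i t) (sym M′it)) (free i t))))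

        column-far : ∀ j → M′ j t₀ ≡ true → suc k ℕ.≤ distance (toℕ i) (toℕ j)
        column-far j M′jt₀ with j ≟ i
        ... | yes refl = ⊥-elim (true≢false (trans (sym M′jt₀) (row-free t₀)))
        ... | no j≢i = ℕ.≤-trans d≤j∸i (ℕ.m≤n+m (toℕ j ∸ toℕ i) (toℕ i ∸ toℕ j))
          where
          i<j : suc (toℕ i) ℕ.≤ toℕ j
          i<j = ℕ.≤∧≢⇒< (leftmost j t₀ (M′⊆supp j t₀ M′jt₀)) (λ i≡j → j≢i (toℕ-injective (sym i≡j)))
          j∉strictWindow : strictWindow i j ≡ false
          j∉strictWindow = trans
            (sym (cong₂ (λ a b → a ∨ (b ∧ strictWindow i j)) (dec-false (j ≟ i) j≢i) (dec-true (t₀ ≟ t₀) refl)))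
            (trans (cong (_∧ nbhd j t₀) (sym M′jt₀)) (free j t₀))
          d≤j∸i : suc k ℕ.≤ toℕ j ∸ toℕ i
          d≤j∸i = ℕ.≤-trans (ℕ.≤-reflexive (sym (ℕ.m+n∸m≡n (toℕ i) (suc k))))
                            (ℕ.∸-monoˡ-≤ (toℕ i) (between≡false j∉strictWindow i<j))

        free-gain : ε + weight′ u′ M′ ≤ weight′ u (addEdge M′ i t₀)
        free-gain = begin
          ε + weight′ u′ M′     ≤⟨ +-monoʳ-≤ ε (sum₂-mono-≤ u′≤u-on-M′) ⟩
          ε + weight′ u M′      ≡⟨ +-comm ε (weight′ u M′) ⟩
          weight′ u M′ + ε      ≡⟨ addEdge-weight u (row-free t₀) ⟨
          weight′ u (addEdge M′ i t₀) ∎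
          where
          open ≤-Reasoning
          u′≤u-on-M′ : ∀ s t → ⟪ M′ s t ⟫ u′ s t ≤ ⟪ M′ s t ⟫ u s t
          u′≤u-on-M′ s t with M′ s t in M′st
          ... | true  = u′≤u s t (proj₁ isMatching′ s t M′st)
          ... | false = ≤-refl

        rounding : Rounding u
        rounding = record
          { M          = addEdge M′ i t₀
          ; isMatching = addEdge-isDDistMatching isMatching′ (supp⇒E u supp-it₀) row-free column-far
          ; M⊆supp     = λ s t e → [ M′⊆supp s t , (λ { (refl , refl) → supp-it₀ }) ]′ (addEdge-cases {M = M′} e)
          ; bound      = bound-from-gain M′ (addEdge M′ i t₀) bound′ free-gain
          }

      extend : Rounding u
      extend with any? (λ s → any? (λ t → (M′ s t ∧ nbhd s t) Bool.≟ true))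
      ... | yes (s₁ , t₁ , hit) = record
        { M          = M′
        ; isMatching = isMatching′
        ; M⊆supp     = M′⊆supp
        ; bound      = bound-from-gain M′ M′ bound′ (conflict-gain hit)
        }
      ... | no none = Free.rounding (λ s t → Bool.¬-not (λ hit → none (s , t , hit)))

  rounding : ∀ u → NonNegW E u → Acc ℕ._<_ (count (supp u)) → Rounding u
  rounding u 0≤u (acc rec) with least? (λ i → any? (λ t → supp u i t Bool.≟ true))
  ... | inj₁ empty = empty-rounding u (λ s t → Bool.¬-not (λ sp → empty s (t , sp)))
  ... | inj₂ (i , (t₀ , supp-it₀) , leftmost) with light-edge u supp-it₀
  ...   | t , supp-it , light = S.Extend.extend (rounding S.u′ S.0≤u′ (rec shrinks))
    where
    module S = Step u 0≤u (λ j t′ sp → leftmost j (t′ , sp)) supp-it light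
    shrinks : count (supp S.u′) ℕ.< count (supp u)
    shrinks = count-< S.supp-u′⇒supp-u supp-it S.¬supp-u′-it₀

theorem3 : (n m : ℕ) (E : Graph n m) (w : Fin n → Fin m → ℚ) → NonNegW E w →
    (k : ℕ) (x : Fin n → Fin m → ℚ) → LP1-feasible E (suc k) x →
    ∃ λ (M : Fin n → Fin m → Bool) →
      IsDDistMatching E (suc k) M × (LP1-value E w x ≤ ratio k * weight w M)
theorem3 n m E w 0≤w k x (0≤x , degree , window) =
  M , isMatching , subst₂ _≤_ (sym (Σ[<]₂≡sum₂ λ s t → onE E (λ a b → w a b * x a b) s t))
                             (cong (ratio k *_) (sym (Σ[<]₂≡sum₂ λ s t → if M s t then w s t else 0ℚ))) bound
  where
  open LocalRatio E k x 0≤x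
    (λ s → subst (_≤ 1ℚ) (Σ[<]≡sum (λ t → onE E x s t)) (degree s))
    (λ i t → subst (_≤ 1ℚ) (Σ[<]≡sum (λ s → if inR (suc k) i s then onE E x s t else 0ℚ)) (window i t))
  open Rounding (rounding w 0≤w (ℕ.<-wellFounded _))
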